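{- (Disjunction property.) For all formulas $A,B$: if $\mathsf{IEL}^{ - }\vdash A\vee B$, then $\mathsf{IEL}^{ - }\vdash A$ or $\mathsf{IEL}^{ - }\vdash B$.
   Context: Formulas: built from propositional atoms and $\bot$ by $\wedge,\vee,\rightarrow$ and a unary modality $\Box$. $\mathsf{IEL}^{ - }$ is the natural deduction system with the usual intuitionistic (NJ) introduction/elimination rules for $\wedge,\vee,\rightarrow$, ex falso ($\bot$-elimination), and the $\Box$-intro rule: from deductions of $\Box A_1,\dots,\Box A_n$ (from assumptions $\Gamma_1,\dots,\Gamma_n$) and a deduction of $B$ from assumptions $A_1,\dots,A_n,\Delta$, infer $\Box B$, discharging $A_1,\dots,A_n$ ($n\ge0$). $\mathsf{IEL}^{ - }\vdash A$ means $A$ has a deduction with no undischarged assumptions. -}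

module Defs where

open import Data.Nat using (ℕ)
open import Data.List using (List; []; _∷_; _++_)
open import Data.List.Membership.Propositional using (_∈_)
open import Data.List.Relation.Unary.All using (All)

data Fm : Set where
  atom : ℕ → Fm
  ⊥'   : Fm
  _∧'_ : Fm → Fm → Fm
  _∨'_ : Fm → Fm → Fm
  _⇒_  : Fm → Fm → Fm
  □_   : Fm → Fm

infixr 6 _∧'_
infixr 5 _∨'_
infixr 4 _⇒_
infix 7 □_

□s : List Fm → List Fm
□s [] = []
□s (A ∷ As) = □ A ∷ □s As

infix 2 _⊢_
data _⊢_ (Γ : List Fm) : Fm → Set where
  ass   : ∀ {A} → A ∈ Γ → Γ ⊢ A
  ∧I    : ∀ {A B} → Γ ⊢ A → Γ ⊢ B → Γ ⊢ A ∧' B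
  ∧E₁   : ∀ {A B} → Γ ⊢ A ∧' B → Γ ⊢ A
  ∧E₂   : ∀ {A B} → Γ ⊢ A ∧' B → Γ ⊢ B
  ∨I₁   : ∀ {A B} → Γ ⊢ A → Γ ⊢ A ∨' B
  ∨I₂   : ∀ {A B} → Γ ⊢ B → Γ ⊢ A ∨' B
  ∨E    : ∀ {A B C} → Γ ⊢ A ∨' B → (A ∷ Γ) ⊢ C → (B ∷ Γ) ⊢ C → Γ ⊢ C
  ⇒I    : ∀ {A B} → (A ∷ Γ) ⊢ B → Γ ⊢ A ⇒ B
  ⇒E    : ∀ {A B} → Γ ⊢ A ⇒ B → Γ ⊢ A → Γ ⊢ B
  ⊥E    : ∀ {A} → Γ ⊢ ⊥' → Γ ⊢ A
  □I    : ∀ {B} (As : List Fm) → All (λ A → Γ ⊢ □ A) As → (As ++ Γ) ⊢ B → Γ ⊢ □ B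

IEL⁻⊢ : Fm → Set
IEL⁻⊢ A = [] ⊢ A

{-# OPTIONS --safe #-}
-- Aczel's slash: call A slashed if it is provable and its slash holds, the
-- slash of a disjunction demanding a slashed disjunct. Deductions from slashed
-- assumptions have slashed conclusions, so a closed proof of A ∨' B exhibits
-- a provable disjunct.
module Submission where

open import Defs
open import Data.Empty using (⊥; ⊥-elim)
open import Data.List.Relation.Unary.All as All using (All; []; _∷_)
open import Data.Product using (_×_; _,_; proj₁; proj₂)
open import Data.Sum as Sum using (_⊎_; inj₁; inj₂)
open import Data.Unit using (⊤; tt)

discharge : ∀ {Γ A} → All IEL⁻⊢ Γ → Γ ⊢ A → IEL⁻⊢ A
discharge []       d = d
discharge (p ∷ ps) d = ⇒E (discharge ps (⇒I d)) p

mutual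
  Slash : Fm → Set
  Slash (atom _) = ⊤
  Slash ⊥'       = ⊥
  Slash (A ∧' B) = Slash A × Slash B
  Slash (A ∨' B) = Slashed A ⊎ Slashed B
  Slash (A ⇒ B)  = Slashed A → Slash B
  -- Harmless because no rule eliminates □: premises □ Aᵢ only feed □-introduction.
  Slash (□ _)    = ⊤

  Slashed : Fm → Set
  Slashed A = IEL⁻⊢ A × Slash A

mutual
  slash-sound : ∀ {Γ A} → Γ ⊢ A → All Slashed Γ → Slash A
  slash-sound (ass x)    η = proj₂ (All.lookup η x)
  slash-sound (∧I d e)   η = slash-sound d η , slash-sound e η
  slash-sound (∧E₁ d)    η = proj₁ (slash-sound d η)
  slash-sound (∧E₂ d)    η = proj₂ (slash-sound d η)
  slash-sound (∨I₁ d)    η = inj₁ (slashed d η)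
  slash-sound (∨I₂ d)    η = inj₂ (slashed d η)
  slash-sound (∨E d e f) η with slash-sound d η
  ... | inj₁ a = slash-sound e (a ∷ η)
  ... | inj₂ b = slash-sound f (b ∷ η)
  slash-sound (⇒I d)     η = λ a → slash-sound d (a ∷ η)
  slash-sound (⇒E d e)   η = slash-sound d η (slashed e η)
  slash-sound (⊥E d)     η = ⊥-elim (slash-sound d η)
  slash-sound (□I _ _ _) η = tt

  slashed : ∀ {Γ A} → Γ ⊢ A → All Slashed Γ → Slashed A
  slashed d η = discharge (All.map proj₁ η) d , slash-sound d η

corollary33 : (A B : Fm) → IEL⁻⊢ (A ∨' B) → IEL⁻⊢ A ⊎ IEL⁻⊢ B
corollary33 A B d = Sum.map proj₁ proj₁ (slash-sound d [])
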